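{- For all formulas $\phi,\psi$ of $\mathcal{RCD}$ and all groups $G_1,\dots,G_n,H$: if $\phi\to(E_H\phi\wedge R_{G_1}\cdots R_{G_n}\psi)$ is valid, then $\phi\to R_{G_1}\cdots R_{G_n}C_H\psi$ is valid.
   Context: Fix a countable set $\textsc{prop}$ of propositional variables and a finite set $\textsc{ag}$ of agents; groups are nonempty subsets of $\textsc{ag}$. The language $\mathcal{RCD}$ is $\phi ::= p \mid \neg\phi \mid \phi\wedge\phi \mid K_i\phi \mid D_G\phi \mid C_G\phi \mid R_G\phi$; $E_H\phi$ abbreviates $\bigwedge_{i\in H}K_i\phi$. A model is $\mathfrak{M}=(S,\sim,V)$ with each $\sim_i$ an equivalence relation on $S$ and $V:\textsc{prop}\to 2^S$; $\sim_G=\bigcap_{i\in G}\sim_i$. The $G$-resolved update is $\mathfrak{M}|_G=(S,\sim|_G,V)$ with $(\sim|_G)_i=\sim_G$ for $i\in G$ and $\sim_i$ otherwise. Satisfaction: atoms via $V$; Booleans as usual; $K_i\phi$ at $s$ iff $\phi$ at all $t$ with $s\sim_it$; $D_G\phi$ iff $\phi$ at all $t$ with $s\sim_Gt$; $C_G\phi$ iff $\phi$ at all $t$ reachable from $s$ via the reflexive transitive closure of $\bigcup_{i\in G}\sim_i$; $\mathfrak{M},s\models R_G\phi$ iff $\mathfrak{M}|_G,s\models\phi$. Valid = true at every state of every model. -}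

module Defs where

open import Level using (0ℓ)
open import Data.Nat using (ℕ)
open import Data.Fin using (Fin)
open import Data.Fin.Subset using (Subset; Nonempty; _∈_)
open import Data.Fin.Subset.Properties using (_∈?_)
open import Data.List using (List; []; _∷_; filter; allFin)
open import Data.Product using (Σ; _×_; proj₁)
open import Relation.Nullary using (yes; no)
open import Data.Empty using (⊥)
open import Relation.Binary using (IsEquivalence)
open import Relation.Binary.Construct.Closure.ReflexiveTransitive using (Star)

Group : ℕ → Set
Group m = Σ (Subset m) Nonempty

data Form (m : ℕ) : Set where
  var : ℕ → Form m
  ¬'_ : Form m → Form m
  _∧'_ : Form m → Form m → Form m
  K : Fin m → Form m → Form m
  D : Group m → Form m → Form m
  C : Group m → Form m → Form m
  R : Group m → Form m → Form m

infixr 6 _∧'_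
infixr 5 _⇒'_

_⇒'_ : ∀ {m} → Form m → Form m → Form m
φ ⇒' ψ = ¬' (φ ∧' ¬' ψ)

-- A tautology, used only as the conjunction of the empty list
-- (never actually needed since groups are nonempty).
⊤' : ∀ {m} → Form m
⊤' = ¬' (var 0 ∧' ¬' var 0)

⋀ : ∀ {m} → List (Form m) → Form m
⋀ [] = ⊤'
⋀ (φ ∷ []) = φ
⋀ (φ ∷ ψs@(_ ∷ _)) = φ ∧' ⋀ ψs

mapK : ∀ {m} → List (Fin m) → Form m → List (Form m)
mapK [] φ = []
mapK (i ∷ is) φ = K i φ ∷ mapK is φ

E : ∀ {m} → Group m → Form m → Form m
E {m} H φ = ⋀ (mapK (filter (_∈? proj₁ H) (allFin m)) φ)

Rs : ∀ {m} → List (Group m) → Form m → Form m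
Rs [] ψ = ψ
Rs (G ∷ Gs) ψ = R G (Rs Gs ψ)

-- Structures: states S, relations ∼ i, valuation V : ℕ → 2^S.
-- (Models are structures whose relations are equivalences; see IsModel.)
record Model (m : ℕ) : Set₁ where
  field
    S : Set
    rel : Fin m → S → S → Set
    V : ℕ → S → Set

open Model public

IsModel : ∀ {m} → Model m → Set
IsModel {m} M = (i : Fin m) → IsEquivalence (rel M i)

relG : ∀ {m} (M : Model m) → Group m → S M → S M → Set
relG M G s t = ∀ i → i ∈ proj₁ G → rel M i s t

relU : ∀ {m} (M : Model m) → Group m → S M → S M → Set
relU {m} M G s t = Σ (Fin m) λ i → (i ∈ proj₁ G) × rel M i s t

updRel : ∀ {m} (M : Model m) (G : Group m) → Fin m → S M → S M → Set
updRel M G i with i ∈? proj₁ G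
... | yes _ = relG M G
... | no _ = rel M i

_∣_ : ∀ {m} → Model m → Group m → Model m
M ∣ G = record { S = S M ; rel = updRel M G ; V = V M }

_,_⊨_ : ∀ {m} (M : Model m) → S M → Form m → Set
M , s ⊨ var p = V M p s
M , s ⊨ (¬' φ) = (M , s ⊨ φ) → ⊥
M , s ⊨ (φ ∧' ψ) = (M , s ⊨ φ) × (M , s ⊨ ψ)
M , s ⊨ K i φ = ∀ t → rel M i s t → M , t ⊨ φ
M , s ⊨ D G φ = ∀ t → relG M G s t → M , t ⊨ φ
M , s ⊨ C G φ = ∀ t → Star (relU M G) s t → M , t ⊨ φ
M , s ⊨ R G φ = (M ∣ G) , s ⊨ φ

Valid : ∀ {m} → Form m → Set₁
Valid {m} φ = (M : Model m) → IsModel M → (s : S M) → M , s ⊨ φ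

-- The fixed point argument for common knowledge: φ is closed under every ∼ᵢ with
-- i ∈ H (because φ → E_H φ), and a resolved update only refines relations, so φ
-- stays closed in M|_{G₁}⋯|_{Gₙ}. There the C_H-reachable states from a φ-state are
-- φ-states, all of which satisfy ψ in the updated model since φ → R_{G₁}⋯R_{Gₙ} ψ.

module Submission where

open import Defs
open import Level using (0ℓ)
open import Data.Nat using (ℕ)
open import Data.List using (List; []; _∷_)
open import Axiom.ExcludedMiddle using (ExcludedMiddle)
open import Axiom.DoubleNegationElimination using (em⇒dne)
open import Data.Fin using (Fin)
open import Data.Fin.Subset using () renaming (_∈_ to _∈ₛ_)
open import Data.Fin.Subset.Properties using (_∈?_)
open import Data.Product using (_,_; proj₁; proj₂)
open import Relation.Nullary using (yes; no)
open import Relation.Binary.PropositionalEquality using (refl)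
open import Relation.Binary.Construct.Closure.ReflexiveTransitive using (ε; _◅_)
open import Data.List.Membership.Propositional using (_∈_)
open import Data.List.Membership.Propositional.Properties using (∈-filter⁺; ∈-allFin)
open import Data.List.Relation.Unary.Any using (here; there)

updRel⇒rel : ∀ {m} (M : Model m) (G : Group m) (i : Fin m) {s t : S M}
  → updRel M G i s t → rel M i s t
updRel⇒rel M G i with i ∈? proj₁ G
... | yes i∈G = λ s∼Gt → s∼Gt i i∈G
... | no _    = λ s∼t → s∼t

⋀-mapK⇒K : ∀ {m} (M : Model m) (φ : Form m) {is : List (Fin m)} {i : Fin m} {s : S M}
  → i ∈ is → M , s ⊨ ⋀ (mapK is φ) → M , s ⊨ K i φ
⋀-mapK⇒K M φ {_ ∷ []}    (here refl) Kφ = Kφ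
⋀-mapK⇒K M φ {_ ∷ _ ∷ _} (here refl) Kφs = proj₁ Kφs
⋀-mapK⇒K M φ {_ ∷ _ ∷ _} (there i∈) Kφs = ⋀-mapK⇒K M φ i∈ (proj₂ Kφs)

E⇒K : ∀ {m} (M : Model m) (H : Group m) (φ : Form m) {i : Fin m} {s : S M}
  → i ∈ₛ proj₁ H → M , s ⊨ E H φ → M , s ⊨ K i φ
E⇒K M H φ {i} i∈H =
  ⋀-mapK⇒K M φ (∈-filter⁺ (_∈? proj₁ H) (∈-allFin i) i∈H)

⇒'-elim : ExcludedMiddle 0ℓ → ∀ {m} (M : Model m) (φ ψ : Form m) {s : S M}
  → M , s ⊨ (φ ⇒' ψ) → M , s ⊨ φ → M , s ⊨ ψ
⇒'-elim em M _ _ φ⇒ψ φ = em⇒dne em (λ ¬ψ → φ⇒ψ (φ , ¬ψ))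

Closed : ∀ {m} (M : Model m) → Group m → (S M → Set) → Set
Closed {m} M H P = ∀ {i : Fin m} {s t : S M} → i ∈ₛ proj₁ H → rel M i s t → P s → P t

Closed-∣ : ∀ {m} (M : Model m) (G H : Group m) {P : S M → Set}
  → Closed M H P → Closed (M ∣ G) H P
Closed-∣ M G H closed {i} i∈H s∼t = closed i∈H (updRel⇒rel M G i s∼t)

Closed⇒C : ∀ {m} (M : Model m) (H : Group m) (ψ : Form m) {P : S M → Set}
  → Closed M H P → (∀ {t} → P t → M , t ⊨ ψ) → ∀ {s} → P s → M , s ⊨ C H ψ
Closed⇒C M H ψ closed P⇒ψ Ps _ ε = P⇒ψ Ps
Closed⇒C M H ψ closed P⇒ψ Ps t ((i , i∈H , s∼u) ◅ u⇝t) =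
  Closed⇒C M H ψ closed P⇒ψ (closed i∈H s∼u Ps) t u⇝t

Closed⇒Rs-C : ∀ {m} (M : Model m) (Gs : List (Group m)) (H : Group m) (ψ : Form m)
  {P : S M → Set} → Closed M H P
  → (∀ {t} → P t → M , t ⊨ Rs Gs ψ) → ∀ {s} → P s → M , s ⊨ Rs Gs (C H ψ)
Closed⇒Rs-C M []       H ψ closed = Closed⇒C M H ψ closed
Closed⇒Rs-C M (G ∷ Gs) H ψ closed = Closed⇒Rs-C (M ∣ G) Gs H ψ (Closed-∣ M G H closed)

lemma1 : ExcludedMiddle 0ℓ → (m : ℕ) → (φ ψ : Form m) → (Gs : List (Group m)) → (H : Group m)
    → Valid (φ ⇒' (E H φ ∧' Rs Gs ψ)) → Valid (φ ⇒' Rs Gs (C H ψ))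
lemma1 em m φ ψ Gs H valid M isModel s (φs , ¬Rs-C) =
  ¬Rs-C (Closed⇒Rs-C M Gs H ψ φ-closed (λ φt → proj₂ (consequences φt)) φs)
  where
  consequences : ∀ {t} → M , t ⊨ φ → M , t ⊨ (E H φ ∧' Rs Gs ψ)
  consequences {t} = ⇒'-elim em M φ (E H φ ∧' Rs Gs ψ) (valid M isModel t)

  φ-closed : Closed M H (λ t → M , t ⊨ φ)
  φ-closed {t = t} i∈H s∼t φs = E⇒K M H φ i∈H (proj₁ (consequences φs)) t s∼t
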